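{- Let $\mathbf A$ be an $\mathbf{I}_{2,0}$-chain and $a,b\in A$. Then $a'\to b'=b\to a$.
   Context: A zroupoid is an algebra $\langle A,\to,0\rangle$ with binary $\to$ and constant $0$; $x':=x\to 0$. An implication zroupoid satisfies (I) $(x\to y)\to z\approx[(z'\to x)\to(y\to z)']'$ and $0''\approx 0$; $\mathbf{I}_{2,0}$ is the variety of implication zroupoids satisfying $x''\approx x$. For $x,y\in A$, $x\sqsubseteq y$ iff $(x\to y')'=x$. An $\mathbf{I}_{2,0}$-chain is a member of $\mathbf{I}_{2,0}$ on which $\sqsubseteq$ is a total order. -}

module Defs where

open import Level using (Level; suc; _⊔_)
open import Relation.Binary.PropositionalEquality using (_≡_)
open import Data.Sum using (_⊎_)

record Zroupoid (a : Level) : Set (suc a) where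
  infixr 5 _⇒_
  field
    Carrier : Set a
    _⇒_     : Carrier → Carrier → Carrier
    𝟎       : Carrier

  _′ : Carrier → Carrier
  x ′ = x ⇒ 𝟎

  _⊑_ : Carrier → Carrier → Set a
  x ⊑ y = ((x ⇒ (y ′)) ′) ≡ x

record IsImplicationZroupoid {a} (Z : Zroupoid a) : Set a where
  open Zroupoid Z
  field
    I-law : ∀ x y z → ((x ⇒ y) ⇒ z) ≡ (((((z ′) ⇒ x) ⇒ ((y ⇒ z) ′)) ′))
    0''   : ((𝟎 ′) ′) ≡ 𝟎

record IsI20 {a} (Z : Zroupoid a) : Set a where
  open Zroupoid Z
  field
    isImplicationZroupoid : IsImplicationZroupoid Z
    involution            : ∀ x → ((x ′) ′) ≡ x

record IsI20Chain {a} (Z : Zroupoid a) : Set a where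
  open Zroupoid Z
  field
    isI20     : IsI20 Z
    ⊑-refl    : ∀ x → x ⊑ x
    ⊑-antisym : ∀ x y → x ⊑ y → y ⊑ x → x ≡ y
    ⊑-trans   : ∀ x y z → x ⊑ y → y ⊑ z → x ⊑ z
    ⊑-total   : ∀ x y → (x ⊑ y) ⊎ (y ⊑ x)

module Submission where

-- The proof works in any member of I₂,₀ whose relation ⊑ is reflexive.
-- Reflexivity (x → x′)′ = x together with x″ = x gives the two absorption
-- laws x → x′ = x′ and x′ → x = x.  Using these, two applications of the
-- identity (I) show the key fact: whenever a → b = a′, contraposition
-- a′ → b′ = b → a holds.  The hypothesis a → b = a′ is exactly a ⊑ b′
-- (up to involution).  In a chain, either a ⊑ b′ or b′ ⊑ a = (a′)′, and
-- the second case is the first one applied to the pair (b′, a′).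

open import Defs
open import Relation.Binary.PropositionalEquality
  using (_≡_; sym; trans; cong; cong₂; module ≡-Reasoning)
open import Data.Sum using (inj₁; inj₂)

module ReflexiveI20 {ℓ} (A : Zroupoid ℓ) (I20 : IsI20 A)
                    (⊑-refl : ∀ x → Zroupoid._⊑_ A x x) where
  open Zroupoid A
  open IsI20 I20
  open IsImplicationZroupoid isImplicationZroupoid
  open ≡-Reasoning

  ⇒-complement : ∀ x → (x ⇒ (x ′)) ≡ x ′
  ⇒-complement x = trans (sym (involution _)) (cong _′ (⊑-refl x))

  complement-⇒ : ∀ x → ((x ′) ⇒ x) ≡ x
  complement-⇒ x = begin
      (x ′) ⇒ x          ≡⟨ cong ((x ′) ⇒_) (sym (involution x)) ⟩
      (x ′) ⇒ ((x ′) ′)  ≡⟨ ⇒-complement (x ′) ⟩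
      (x ′) ′            ≡⟨ involution x ⟩
      x                  ∎

  ⊑-complement⇒ : ∀ a b → a ⊑ (b ′) → (a ⇒ b) ≡ a ′
  ⊑-complement⇒ a b a⊑b′ = begin
      a ⇒ b                  ≡⟨ cong (a ⇒_) (sym (involution b)) ⟩
      a ⇒ ((b ′) ′)          ≡⟨ sym (involution _) ⟩
      ((a ⇒ ((b ′) ′)) ′) ′  ≡⟨ cong _′ a⊑b′ ⟩
      a ′                    ∎

  contraposition : ∀ a b → (a ⇒ b) ≡ a ′ → ((a ′) ⇒ (b ′)) ≡ (b ⇒ a)
  contraposition a b a⇒b≡a′ = begin
      (a ′) ⇒ (b ′)
    ≡⟨ cong (_⇒ (b ′)) (sym a⇒b≡a′) ⟩
      (a ⇒ b) ⇒ (b ′)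
    ≡⟨ I-law a b (b ′) ⟩
      ((((b ′) ′) ⇒ a) ⇒ ((b ⇒ (b ′)) ′)) ′
    ≡⟨ cong _′ (cong₂ _⇒_ (cong (_⇒ a) (involution b))
                          (trans (cong _′ (⇒-complement b)) (involution b))) ⟩
      ((b ⇒ a) ⇒ b) ′
    ≡⟨ cong _′ (I-law b a b) ⟩
      ((((b ′) ⇒ b) ⇒ ((a ⇒ b) ′)) ′) ′
    ≡⟨ involution _ ⟩
      ((b ′) ⇒ b) ⇒ ((a ⇒ b) ′)
    ≡⟨ cong₂ _⇒_ (complement-⇒ b) (trans (cong _′ a⇒b≡a′) (involution a)) ⟩
      b ⇒ a
    ∎

module Chain {ℓ} (A : Zroupoid ℓ) (chain : IsI20Chain A) where
  open Zroupoid A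
  open IsI20Chain chain
  open IsI20 isI20 using (involution)
  open ReflexiveI20 A isI20 ⊑-refl
  open ≡-Reasoning

  contraposition-everywhere : ∀ a b → ((a ′) ⇒ (b ′)) ≡ (b ⇒ a)
  contraposition-everywhere a b with ⊑-total a (b ′)
  ... | inj₁ a⊑b′ = contraposition a b (⊑-complement⇒ a b a⊑b′)
  ... | inj₂ b′⊑a = begin
      (a ′) ⇒ (b ′)           ≡⟨ sym (contraposition (b ′) (a ′) b′⇒a′≡b″) ⟩
      ((b ′) ′) ⇒ ((a ′) ′)   ≡⟨ cong₂ _⇒_ (involution b) (involution a) ⟩
      b ⇒ a                   ∎
    where
      -- b′ ⊑ a = (a′)′, so the first case applies to the pair (b′, a′).
      b′⇒a′≡b″ : ((b ′) ⇒ (a ′)) ≡ (b ′) ′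
      b′⇒a′≡b″ = ⊑-complement⇒ (b ′) (a ′)
                   (trans (cong (λ y → ((b ′) ⇒ (y ′)) ′) (involution a)) b′⊑a)

lemma5p6 : ∀ {ℓ} (A : Zroupoid ℓ) → IsI20Chain A →
    ∀ (a b : Zroupoid.Carrier A) →
      Zroupoid._⇒_ A (Zroupoid._′ A a) (Zroupoid._′ A b) ≡ Zroupoid._⇒_ A b a
lemma5p6 A chain = Chain.contraposition-everywhere A chain
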